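{- Let $F$ be a field of characteristic not $2$ with $\sqrt{ -1}\in F$, $a\in F^\times\setminus F^{\times 2}$, $E=F(\sqrt{a})$ and $G=\mathrm{Gal}(E/F)$. Then $k_1E=E^\times/E^{\times 2}$ is not a free $\mathbb{F}_2[G]$-module.
   Context: $k_1E=K_1E/2K_1E\cong E^\times/E^{\times 2}$ (mod-$2$ Milnor $K$-group), with the natural action of $G$. -}

module Defs where

open import Level using (Level; _⊔_; suc)
open import Algebra.Bundles using (CommutativeRing)
open import Data.Product using (Σ; ∃; _×_; _,_; proj₁; proj₂)
open import Data.Bool using (Bool; true; false)
open import Data.List using (List; []; _∷_; map)
open import Data.List.Relation.Unary.All using (All)
open import Data.List.Relation.Unary.Unique.Propositional using (Unique)
open import Relation.Nullary using (¬_)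

record Field (c ℓ : Level) : Set (suc (c ⊔ ℓ)) where
  field
    commutativeRing : CommutativeRing c ℓ
  open CommutativeRing commutativeRing public
  field
    1≉0     : ¬ (1# ≈ 0#)
    inverse : ∀ x → ¬ (x ≈ 0#) → ∃ λ y → x * y ≈ 1#

module QuadraticExtension {c ℓ : Level} (F : Field c ℓ) (a : Field.Carrier F) where
  open Field F

  -- E = F(√a) = F[t]/(t² - a), an element (x , y) stands for x + y √a.
  E : Set c
  E = Carrier × Carrier

  _≈E_ : E → E → Set ℓ
  (x , y) ≈E (u , v) = (x ≈ u) × (y ≈ v)

  _·_ : E → E → E
  (x , y) · (u , v) = (x * u + a * (y * v)) , (x * v + y * u)

  oneE : E
  oneE = 1# , 0#

  -- E^× : nonzero elements of E (all invertible, as a is a nonsquare).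
  Eˣ : Set (c ⊔ ℓ)
  Eˣ = Σ E λ z → ¬ ((proj₁ z ≈ 0#) × (proj₂ z ≈ 0#))

  σ : E → E
  σ (x , y) = x , (- y)

  -- Equality in k₁E = E^×/E^{×2}: z ~ w iff z = w · t² for some t ∈ E^×.
  _~_ : Eˣ → Eˣ → Set (c ⊔ ℓ)
  (z , _) ~ (w , _) = ∃ λ (t : Eˣ) → z ≈E (w · (proj₁ t · proj₁ t))

  -- Elements of F₂[G] = F₂[{1,σ}]: (b₁ , bσ) stands for b₁·1 + bσ·σ.
  F₂G : Set
  F₂G = Bool × Bool

  -- The F₂[G]-action on k₁E, written multiplicatively on representatives.
  act : F₂G → E → E
  act (false , false) z = oneE
  act (true  , false) z = z
  act (false , true ) z = σ z
  act (true  , true ) z = z · σ z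

  isZero : F₂G → Set
  isZero (false , false) = Data.Unit.⊤ where import Data.Unit
  isZero (_ , _)         = Data.Empty.⊥ where import Data.Empty

  -- Finite F₂[G]-linear combination Σ cᵢ · b(iᵢ), written multiplicatively.
  combo : {B : Set (c ⊔ ℓ)} → (B → Eˣ) → List (F₂G × B) → E
  combo b []            = oneE
  combo b ((r , i) ∷ l) = act r (proj₁ (b i)) · combo b l

  oneEˣ : Eˣ
  oneEˣ = oneE , λ p → 1≉0 (proj₁ p)

  IsBasis : {B : Set (c ⊔ ℓ)} → (B → Eˣ) → Set (c ⊔ ℓ)
  IsBasis {B} b =
      (∀ (m : Eˣ) → ∃ λ (l : List (F₂G × B)) →
          ∃ λ (ok : ¬ ((proj₁ (combo b l) ≈ 0#) × (proj₂ (combo b l) ≈ 0#))) →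
            (combo b l , ok) ~ m)
    × (∀ (l : List (F₂G × B)) → Unique (map proj₂ l) →
          ∀ (ok : ¬ ((proj₁ (combo b l) ≈ 0#) × (proj₂ (combo b l) ≈ 0#))) →
          (combo b l , ok) ~ oneEˣ → All (λ p → isZero (proj₁ p)) l)

  k₁E-IsFree : Set (suc (c ⊔ ℓ))
  k₁E-IsFree = ∃ λ (B : Set (c ⊔ ℓ)) → ∃ λ (b : B → Eˣ) → IsBasis b

CharNot2 : ∀ {c ℓ} (F : Field c ℓ) → Set ℓ
CharNot2 F = ¬ (1# + 1# ≈ 0#) where open Field F

HasSqrtMinus1 : ∀ {c ℓ} (F : Field c ℓ) → Set (c ⊔ ℓ)
HasSqrtMinus1 F = ∃ λ i → i * i ≈ - 1# where open Field F

IsNonSquareUnit : ∀ {c ℓ} (F : Field c ℓ) → Field.Carrier F → Set (c ⊔ ℓ)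
IsNonSquareUnit F a = ¬ (a ≈ 0#) × ¬ (∃ λ b → b * b ≈ a) where open Field F

k₁E-IsFree : ∀ {c ℓ} (F : Field c ℓ) (a : Field.Carrier F) → Set (suc (c ⊔ ℓ))
k₁E-IsFree F a = QuadraticExtension.k₁E-IsFree F a

-- The class of √a is killed by 1 + σ, since √a · σ√a = -a = (√-1 √a)².  In F₂[G] the
-- kernel of multiplication by 1 + σ is {0, 1 + σ}, so if k₁E had an F₂[G]-basis, every
-- coordinate of [√a] would be 0 or 1 + σ; as (1 + σ) · [b] = [b · σb] = [N(b)], the
-- class [√a] would then contain an element of F.  But c (p + q√a)² = √a with c ∈ F
-- forces p² = -a q², so a = (√-1 p / q)² would be a square.
module Submission where

open import Defs
open import Level using (Level; _⊔_)
open import Algebra.Bundles using (CommutativeMonoid)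
open import Data.Bool using (Bool; true; false; _xor_)
open import Data.List using (List; []; _∷_; map)
open import Data.List.Properties using (map-∘)
open import Data.List.Relation.Binary.Subset.Propositional using (_⊆_)
open import Data.List.Relation.Binary.Subset.Propositional.Properties
  using (⊆-trans; xs⊆x∷xs; ∷⁺ʳ; ∈-∷⁺ʳ)
open import Data.List.Relation.Unary.All using (All; []; _∷_)
open import Data.List.Relation.Unary.All.Properties using (anti-mono)
open import Data.List.Relation.Unary.Any using (here; there)
open import Data.List.Relation.Unary.AllPairs using ([]; _∷_)
open import Data.List.Relation.Unary.Unique.Propositional using (Unique)
open import Data.Product using (Σ; ∃; _×_; _,_; proj₁; proj₂; map₁)
open import Relation.Nullary using (¬_; yes; no)
open import Relation.Nullary.Decidable using (¬¬-excluded-middle)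
open import Relation.Nullary.Negation using (DoubleNegation)
import Relation.Binary.PropositionalEquality as ≡

module FieldProperties {c ℓ : Level} (F : Field c ℓ) where
  open Field F
  open import Relation.Binary.Reasoning.Setoid setoid
  open import Algebra.Solver.Ring.NaturalCoefficients.Default commutativeSemiring
    using (_:*_; _:=_; solve)

  x≈0⇒x*y≈0 : ∀ {x} y → x ≈ 0# → x * y ≈ 0#
  x≈0⇒x*y≈0 y x≈0 = trans (*-congʳ x≈0) (zeroˡ y)

  y≈0⇒x*y≈0 : ∀ x {y} → y ≈ 0# → x * y ≈ 0#
  y≈0⇒x*y≈0 x y≈0 = trans (*-congˡ y≈0) (zeroʳ x)

  *-cancelˡ-≈0 : ∀ {x y} → ¬ (x ≈ 0#) → x * y ≈ 0# → y ≈ 0#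
  *-cancelˡ-≈0 {x} {y} x≉0 xy≈0 with inverse x x≉0
  ... | x⁻¹ , xx⁻¹≈1 = begin
    y              ≈⟨ *-identityˡ y ⟨
    1# * y         ≈⟨ *-congʳ xx⁻¹≈1 ⟨
    (x * x⁻¹) * y  ≈⟨ *-congʳ (*-comm x x⁻¹) ⟩
    (x⁻¹ * x) * y  ≈⟨ *-assoc x⁻¹ x y ⟩
    x⁻¹ * (x * y)  ≈⟨ y≈0⇒x*y≈0 x⁻¹ xy≈0 ⟩
    0#             ∎

  x≉0∧y≉0⇒x*y≉0 : ∀ {x y} → ¬ (x ≈ 0#) → ¬ (y ≈ 0#) → ¬ (x * y ≈ 0#)
  x≉0∧y≉0⇒x*y≉0 x≉0 y≉0 xy≈0 = y≉0 (*-cancelˡ-≈0 x≉0 xy≈0)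

  square-of-ratio : ∀ {d x y} → x * x ≈ d * (y * y) → ¬ (y ≈ 0#) → ∃ λ b → b * b ≈ d
  square-of-ratio {d} {x} {y} xx≈dyy y≉0 with inverse y y≉0
  ... | y⁻¹ , yy⁻¹≈1 = x * y⁻¹ , (begin
    (x * y⁻¹) * (x * y⁻¹)        ≈⟨ solve 2 (λ x z → (x :* z) :* (x :* z) := (x :* x) :* (z :* z))
                                       refl x y⁻¹ ⟩
    (x * x) * (y⁻¹ * y⁻¹)        ≈⟨ *-congʳ xx≈dyy ⟩
    (d * (y * y)) * (y⁻¹ * y⁻¹)  ≈⟨ solve 3 (λ d y z → (d :* (y :* y)) :* (z :* z)
                                                    := d :* ((y :* z) :* (y :* z)))
                                       refl d y y⁻¹ ⟩
    d * ((y * y⁻¹) * (y * y⁻¹))  ≈⟨ *-congˡ (*-cong yy⁻¹≈1 yy⁻¹≈1) ⟩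
    d * (1# * 1#)                ≈⟨ *-congˡ (*-identityˡ 1#) ⟩
    d * 1#                       ≈⟨ *-identityʳ d ⟩
    d                            ∎)

module QuadraticAlgebra {c ℓ : Level} (F : Field c ℓ) (a : Field.Carrier F) where
  open Field F
  open FieldProperties F
  open import Algebra.Properties.Ring ring
    using (-‿involutive; -0#≈0#; -‿distribˡ-*; -‿distribʳ-*; -‿+-comm; +-inverseˡ-unique; -1*x≈-x)
  import Relation.Binary.Reasoning.Setoid setoid as ≈-Reasoning
  open import Algebra.Solver.Ring.NaturalCoefficients.Default commutativeSemiring
    using (_:*_; _:+_; _:=_; solve)
  open QuadraticExtension F a hiding (k₁E-IsFree)

  -- A record, so that z and w stay inferable from z ≋ w (z ≈E w unfolds to a pair).
  infix 4 _≋_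
  record _≋_ (z w : E) : Set ℓ where
    constructor ⟪_⟫
    field components : z ≈E w
  open _≋_

  ≋-refl : ∀ {z} → z ≋ z
  ≋-refl {x , y} = ⟪ refl , refl ⟫

  ≋-sym : ∀ {z w} → z ≋ w → w ≋ z
  ≋-sym {x , y} {u , v} ⟪ x≈u , y≈v ⟫ = ⟪ sym x≈u , sym y≈v ⟫

  ≋-trans : ∀ {z w s} → z ≋ w → w ≋ s → z ≋ s
  ≋-trans {x , y} {u , v} {p , q} ⟪ x≈u , y≈v ⟫ ⟪ u≈p , v≈q ⟫ = ⟪ trans x≈u u≈p , trans y≈v v≈q ⟫

  ·-cong : ∀ {z z' w w'} → z ≋ z' → w ≋ w' → z · w ≋ z' · w'
  ·-cong {x , y} {x' , y'} {u , v} {u' , v'} ⟪ x≈ , y≈ ⟫ ⟪ u≈ , v≈ ⟫ =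
    ⟪ +-cong (*-cong x≈ u≈) (*-congˡ (*-cong y≈ v≈)) , +-cong (*-cong x≈ v≈) (*-cong y≈ u≈) ⟫

  ·-comm : ∀ z w → z · w ≋ w · z
  ·-comm (x , y) (u , v) =
    ⟪ +-cong (*-comm x u) (*-congˡ (*-comm y v))
    , trans (+-comm (x * v) (y * u)) (+-cong (*-comm y u) (*-comm x v)) ⟫

  ·-assoc : ∀ z w s → (z · w) · s ≋ z · (w · s)
  ·-assoc (x , y) (u , v) (p , q) =
    ⟪ solve 7 (λ a x y u v p q →
        (x :* u :+ a :* (y :* v)) :* p :+ a :* ((x :* v :+ y :* u) :* q)
        := x :* (u :* p :+ a :* (v :* q)) :+ a :* (y :* (u :* q :+ v :* p)))
        refl a x y u v p q
    , solve 7 (λ a x y u v p q →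
        (x :* u :+ a :* (y :* v)) :* q :+ (x :* v :+ y :* u) :* p
        := x :* (u :* q :+ v :* p) :+ y :* (u :* p :+ a :* (v :* q)))
        refl a x y u v p q ⟫

  ·-identityˡ : ∀ z → oneE · z ≋ z
  ·-identityˡ (x , y) =
    ⟪ trans (+-cong (*-identityˡ x) (y≈0⇒x*y≈0 a (zeroˡ y))) (+-identityʳ x)
    , trans (+-cong (*-identityˡ y) (zeroˡ x)) (+-identityʳ y) ⟫

  ·-identityʳ : ∀ z → z · oneE ≋ z
  ·-identityʳ z = ≋-trans (·-comm z oneE) (·-identityˡ z)

  commutativeMonoid : CommutativeMonoid c ℓ
  commutativeMonoid = record
    { Carrier = E ; _≈_ = _≋_ ; _∙_ = _·_ ; ε = oneE
    ; isCommutativeMonoid = record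
      { isMonoid = record
        { isSemigroup = record
          { isMagma = record
            { isEquivalence = record { refl = ≋-refl ; sym = ≋-sym ; trans = ≋-trans }
            ; ∙-cong = ·-cong }
          ; assoc = ·-assoc }
        ; identity = ·-identityˡ , ·-identityʳ }
      ; comm = ·-comm } }

  open import Algebra.Properties.CommutativeSemigroup
    (CommutativeMonoid.commutativeSemigroup commutativeMonoid) using (interchange; x∙yz≈y∙xz)

  ·-interchange : ∀ x y z w → (x · y) · (z · w) ≋ (x · z) · (y · w)
  ·-interchange = interchange

  ·-left-comm : ∀ x y z → x · (y · z) ≋ y · (x · z)
  ·-left-comm = x∙yz≈y∙xz

  ·-squares : ∀ w t s → (w · (t · t)) · (s · s) ≋ w · ((t · s) · (t · s))
  ·-squares w t s = ≋-trans (·-assoc w (t · t) (s · s)) (·-cong (≋-refl {w}) (·-interchange t t s s))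

  σ-cong : ∀ {z w} → z ≋ w → σ z ≋ σ w
  σ-cong {x , y} {u , v} ⟪ x≈u , y≈v ⟫ = ⟪ x≈u , -‿cong y≈v ⟫

  σ-homo : ∀ z w → σ (z · w) ≋ σ z · σ w
  σ-homo (x , y) (u , v) =
    ⟪ +-congˡ (*-congˡ yv≈-y-v)
    , trans (sym (-‿+-comm (x * v) (y * u))) (+-cong (-‿distribʳ-* x v) (-‿distribˡ-* y u)) ⟫
    where
    open ≈-Reasoning
    yv≈-y-v : y * v ≈ (- y) * (- v)
    yv≈-y-v = begin
      y * v          ≈⟨ -‿involutive (y * v) ⟨
      - (- (y * v))  ≈⟨ -‿cong (-‿distribʳ-* y v) ⟩
      - (y * - v)    ≈⟨ -‿distribˡ-* y (- v) ⟩
      (- y) * (- v)  ∎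

  σ-involutive : ∀ z → σ (σ z) ≋ z
  σ-involutive (x , y) = ⟪ refl , -‿involutive y ⟫

  σ-oneE : σ oneE ≋ oneE
  σ-oneE = ⟪ refl , -0#≈0# ⟫

  norm : E → Carrier
  norm (x , y) = x * x + a * (y * - y)

  ·σ≋norm : ∀ z → z · σ z ≋ (norm z , 0#)
  ·σ≋norm (x , y) = ⟪ refl , trans (+-cong (sym (-‿distribʳ-* x y)) (*-comm y x)) (-‿inverseˡ (x * y)) ⟫

  ·-scalarʳ : ∀ z n → z · (n , 0#) ≋ (proj₁ z * n , proj₂ z * n)
  ·-scalarʳ (x , y) n =
    ⟪ trans (+-congˡ (y≈0⇒x*y≈0 a (zeroʳ y))) (+-identityʳ _)
    , trans (+-congʳ (zeroʳ x)) (+-identityˡ _) ⟫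

  ·-oneE² : ∀ z → z · (oneE · oneE) ≋ z
  ·-oneE² z = ≋-trans (·-cong (≋-refl {z}) (·-identityˡ oneE)) (·-identityʳ z)

  ·-zeroˡ : ∀ {z} w → z ≋ (0# , 0#) → z · w ≋ (0# , 0#)
  ·-zeroˡ {x , y} (u , v) ⟪ x≈0 , y≈0 ⟫ =
    ⟪ trans (+-cong (x≈0⇒x*y≈0 u x≈0) (y≈0⇒x*y≈0 a (x≈0⇒x*y≈0 v y≈0))) (+-identityʳ 0#)
    , trans (+-cong (x≈0⇒x*y≈0 v x≈0) (x≈0⇒x*y≈0 u y≈0)) (+-identityʳ 0#) ⟫

  IsScalar : E → Set ℓ
  IsScalar z = proj₂ z ≈ 0#

  IsScalar-· : ∀ z w → IsScalar z → IsScalar w → IsScalar (z · w)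
  IsScalar-· (x , y) (u , v) y≈0 v≈0 =
    trans (+-cong (y≈0⇒x*y≈0 x v≈0) (x≈0⇒x*y≈0 u y≈0)) (+-identityʳ 0#)

  IsScalar-·σ : ∀ z → IsScalar (z · σ z)
  IsScalar-·σ z = proj₂ (components (·σ≋norm z))

  Nonzero : E → Set ℓ
  Nonzero z = ¬ ((proj₁ z ≈ 0#) × (proj₂ z ≈ 0#))

  Nonzero-resp : ∀ {z w} → z ≋ w → Nonzero w → Nonzero z
  Nonzero-resp {x , y} {u , v} ⟪ x≈u , y≈v ⟫ w≉0 (x≈0 , y≈0) =
    w≉0 (trans (sym x≈u) x≈0 , trans (sym y≈v) y≈0)

  oneE-nonzero : Nonzero oneE
  oneE-nonzero (1≈0 , _) = 1≉0 1≈0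

  σ-nonzero : ∀ z → Nonzero z → Nonzero (σ z)
  σ-nonzero (x , y) z≉0 (x≈0 , -y≈0) =
    z≉0 (x≈0 , trans (sym (-‿involutive y)) (trans (-‿cong -y≈0) -0#≈0#))

  module _ (nonsquare : ¬ ∃ λ b → b * b ≈ a) where
    norm-nonzero : ∀ z → Nonzero z → ¬ (norm z ≈ 0#)
    norm-nonzero (x , y) z≉0 norm≈0 = ¬¬-excluded-middle λ
      { (no y≉0) → nonsquare (square-of-ratio xx≈ayy y≉0)
      ; (yes y≈0) → ¬¬-excluded-middle λ
          { (yes x≈0) → z≉0 (x≈0 , y≈0)
          ; (no x≉0) → x≉0∧y≉0⇒x*y≉0 x≉0 x≉0
                         (trans xx≈ayy (y≈0⇒x*y≈0 a (x≈0⇒x*y≈0 y y≈0))) } }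
      where
      xx≈ayy : x * x ≈ a * (y * y)
      xx≈ayy = begin
        x * x               ≈⟨ +-inverseˡ-unique (x * x) _ norm≈0 ⟩
        - (a * (y * - y))   ≈⟨ -‿cong (*-congˡ (-‿distribʳ-* y y)) ⟨
        - (a * - (y * y))   ≈⟨ -‿cong (-‿distribʳ-* a (y * y)) ⟨
        - (- (a * (y * y))) ≈⟨ -‿involutive _ ⟩
        a * (y * y)         ∎
        where
        open ≈-Reasoning

    ·-nonzero : ∀ z w → Nonzero z → Nonzero w → Nonzero (z · w)
    ·-nonzero (x , y) w z≉0 w≉0 zw≈0 =
      z≉0 ( *-cancelˡ-≈0 n≉0 (trans (*-comm _ _) (proj₁ (components xn,yn≈0)))
          , *-cancelˡ-≈0 n≉0 (trans (*-comm _ _) (proj₂ (components xn,yn≈0))))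
      where
      n≉0 : ¬ (norm w ≈ 0#)
      n≉0 = norm-nonzero w w≉0
      xn,yn≈0 : (x * norm w , y * norm w) ≋ (0# , 0#)
      xn,yn≈0 = ≋-trans (≋-sym (·-scalarʳ (x , y) (norm w)))
                (≋-trans (·-cong (≋-refl {x , y}) (≋-sym (·σ≋norm w)))
                (≋-trans (≋-sym (·-assoc (x , y) w (σ w)))
                (·-zeroˡ (σ w) ⟪ zw≈0 ⟫)))

    ·-inverse : ∀ t → Nonzero t → Σ E λ u → Nonzero u × (t · u ≋ oneE)
    ·-inverse t t≉0 = invert (inverse (norm t) (norm-nonzero t t≉0))
      where
      invert : (∃ λ n⁻¹ → norm t * n⁻¹ ≈ 1#) → Σ E λ u → Nonzero u × (t · u ≋ oneE)
      invert (n⁻¹ , nn⁻¹≈1) = σ t · (n⁻¹ , 0#) , ·-nonzero (σ t) (n⁻¹ , 0#) (σ-nonzero t t≉0) n⁻¹≉0 ,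
        ≋-trans (≋-sym (·-assoc t (σ t) (n⁻¹ , 0#)))
        (≋-trans (·-cong (·σ≋norm t) (≋-refl {n⁻¹ , 0#}))
        (≋-trans (·-scalarʳ (norm t , 0#) n⁻¹) ⟪ nn⁻¹≈1 , zeroˡ n⁻¹ ⟫))
        where
        n⁻¹≉0 : Nonzero (n⁻¹ , 0#)
        n⁻¹≉0 (n⁻¹≈0 , _) = 1≉0 (trans (sym nn⁻¹≈1) (y≈0⇒x*y≈0 (norm t) n⁻¹≈0))

    infix 4 _≈²_
    _≈²_ : E → E → Set (c ⊔ ℓ)
    z ≈² w = Σ Eˣ λ t → z ≋ w · (proj₁ t · proj₁ t)

    ≋⇒≈² : ∀ {z w} → z ≋ w → z ≈² w
    ≋⇒≈² {w = w} z≋w = (oneE , oneE-nonzero) , ≋-trans z≋w (≋-sym (·-oneE² w))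

    ≈²-refl : ∀ {z} → z ≈² z
    ≈²-refl = ≋⇒≈² ≋-refl

    ≈²-trans : ∀ {z w s} → z ≈² w → w ≈² s → z ≈² s
    ≈²-trans {s = s} ((t , t≉0) , z≋wtt) ((u , u≉0) , w≋suu) =
      (u · t , ·-nonzero u t u≉0 t≉0) ,
      ≋-trans z≋wtt (≋-trans (·-cong w≋suu (≋-refl {t · t})) (·-squares s u t))

    ≈²-sym : ∀ {z w} → z ≈² w → w ≈² z
    ≈²-sym {z} {w} ((t , t≉0) , z≋wtt) = divide (·-inverse t t≉0)
      where
      open import Relation.Binary.Reasoning.Setoid (CommutativeMonoid.setoid commutativeMonoid)
      divide : (Σ E λ u → Nonzero u × (t · u ≋ oneE)) → w ≈² z
      divide (t⁻¹ , t⁻¹≉0 , tt⁻¹≋1) = (t⁻¹ , t⁻¹≉0) , ≋-sym (begin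
        z · (t⁻¹ · t⁻¹)                   ≈⟨ ·-cong z≋wtt (≋-refl {t⁻¹ · t⁻¹}) ⟩
        (w · (t · t)) · (t⁻¹ · t⁻¹)       ≈⟨ ·-squares w t t⁻¹ ⟩
        w · ((t · t⁻¹) · (t · t⁻¹))       ≈⟨ ·-cong (≋-refl {w}) (·-cong tt⁻¹≋1 tt⁻¹≋1) ⟩
        w · (oneE · oneE)                 ≈⟨ ·-oneE² w ⟩
        w                                 ∎)

    ≈²-·-cong : ∀ {z z' w w'} → z ≈² z' → w ≈² w' → z · w ≈² z' · w'
    ≈²-·-cong {z' = z'} {w' = w'} ((t , t≉0) , z≋) ((u , u≉0) , w≋) =
      (t · u , ·-nonzero t u t≉0 u≉0) ,
      ≋-trans (·-cong z≋ w≋) (≋-trans (·-interchange z' (t · t) w' (u · u))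
        (·-cong (≋-refl {z' · w'}) (·-interchange t t u u)))

    ≈²-σ-cong : ∀ {z w} → z ≈² w → σ z ≈² σ w
    ≈²-σ-cong {w = w} ((t , t≉0) , z≋wtt) =
      (σ t , σ-nonzero t t≉0) ,
      ≋-trans (σ-cong z≋wtt) (≋-trans (σ-homo w (t · t)) (·-cong (≋-refl {σ w}) (σ-homo t t)))

    infix 30 _^_
    _^_ : E → Bool → E
    z ^ false = oneE
    z ^ true  = z

    ^-cong : ∀ {z w} p → z ≋ w → z ^ p ≋ w ^ p
    ^-cong false _   = ≋-refl
    ^-cong true  z≋w = z≋w

    ^-nonzero : ∀ z p → Nonzero z → Nonzero (z ^ p)
    ^-nonzero z false _   = oneE-nonzero
    ^-nonzero z true  z≉0 = z≉0

    σ-^ : ∀ z p → σ (z ^ p) ≋ σ z ^ p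
    σ-^ z false = σ-oneE
    σ-^ z true  = ≋-refl

    ^-xor : ∀ z p q → Nonzero z → z ^ p · z ^ q ≈² z ^ (p xor q)
    ^-xor z false q     _   = ≋⇒≈² (·-identityˡ (z ^ q))
    ^-xor z true  false _   = ≋⇒≈² (·-identityʳ z)
    ^-xor z true  true  z≉0 = (z , z≉0) , ≋-sym (·-identityˡ (z · z))

    act≋^ : ∀ p q z → act (p , q) z ≋ z ^ p · σ z ^ q
    act≋^ false false z = ≋-sym (·-identityˡ oneE)
    act≋^ true  false z = ≋-sym (·-identityʳ z)
    act≋^ false true  z = ≋-sym (·-identityˡ (σ z))
    act≋^ true  true  z = ≋-refl

    act-nonzero : ∀ r z → Nonzero z → Nonzero (act r z)
    act-nonzero (p , q) z z≉0 = Nonzero-resp (act≋^ p q z)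
      (·-nonzero (z ^ p) (σ z ^ q) (^-nonzero z p z≉0) (^-nonzero (σ z) q (σ-nonzero z z≉0)))

    _+₂_ : F₂G → F₂G → F₂G
    (p , q) +₂ (p' , q') = p xor p' , q xor q'

    [1+σ]*_ : F₂G → F₂G
    [1+σ]* (p , q) = p xor q , p xor q

    act-+ : ∀ r r' z → Nonzero z → act r z · act r' z ≈² act (r +₂ r') z
    act-+ (p , q) (p' , q') z z≉0 = ≈²-trans (≋⇒≈² regroup)
      (≈²-trans (≈²-·-cong (^-xor z p p' z≉0) (^-xor (σ z) q q' (σ-nonzero z z≉0)))
                (≋⇒≈² (≋-sym (act≋^ (p xor p') (q xor q') z))))
      where
      regroup : act (p , q) z · act (p' , q') z ≋ (z ^ p · z ^ p') · (σ z ^ q · σ z ^ q')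
      regroup = ≋-trans (·-cong (act≋^ p q z) (act≋^ p' q' z))
        (·-interchange (z ^ p) (σ z ^ q) (z ^ p') (σ z ^ q'))

    act-[1+σ] : ∀ r z → Nonzero z → act r z · σ (act r z) ≈² act ([1+σ]* r) z
    act-[1+σ] (p , q) z z≉0 = ≈²-trans (≋⇒≈² regroup)
      (≈²-trans (≈²-·-cong (^-xor z p q z≉0) (^-xor (σ z) p q (σ-nonzero z z≉0)))
                (≋⇒≈² (≋-sym (act≋^ (p xor q) (p xor q) z))))
      where
      σact : σ (act (p , q) z) ≋ z ^ q · σ z ^ p
      σact = ≋-trans (σ-cong (act≋^ p q z)) (≋-trans (σ-homo (z ^ p) (σ z ^ q))
        (≋-trans (·-cong (σ-^ z p) (≋-trans (σ-^ (σ z) q) (^-cong q (σ-involutive z))))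
                 (·-comm (σ z ^ p) (z ^ q))))
      regroup : act (p , q) z · σ (act (p , q) z) ≋ (z ^ p · z ^ q) · (σ z ^ p · σ z ^ q)
      regroup = ≋-trans (·-cong (act≋^ p q z) σact)
        (≋-trans (·-interchange (z ^ p) (σ z ^ q) (z ^ q) (σ z ^ p))
                 (·-cong (≋-refl {z ^ p · z ^ q}) (·-comm (σ z ^ q) (σ z ^ p))))

    act-scalar : ∀ r z → isZero ([1+σ]* r) → IsScalar (act r z)
    act-scalar (false , false) z _ = refl
    act-scalar (true  , true)  z _ = IsScalar-·σ z
    act-scalar (true  , false) z ()
    act-scalar (false , true)  z ()

    module Combinations {B : Set (c ⊔ ℓ)} (b : B → Eˣ) where
      v : B → E
      v j = proj₁ (b j)

      ids : List (F₂G × B) → List B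
      ids = map proj₂

      combo-nonzero : ∀ l → Nonzero (combo b l)
      combo-nonzero []            = oneE-nonzero
      combo-nonzero ((r , j) ∷ l) = ·-nonzero (act r (v j)) (combo b l)
        (act-nonzero r (v j) (proj₂ (b j))) (combo-nonzero l)

      combo-insert : ∀ r j l₀ → Unique (ids l₀) → DoubleNegation (∃ λ l →
        Unique (ids l) × ids l ⊆ j ∷ ids l₀ × act r (v j) · combo b l₀ ≈² combo b l)
      combo-insert r j [] [] ret = ret ((r , j) ∷ [] , [] ∷ [] , (λ j∈ → j∈) , ≈²-refl)
      combo-insert r j ((r' , k) ∷ l₀) (k∉l₀ ∷ u₀) ret = ¬¬-excluded-middle {A = j ≡.≡ k} λ where
        (yes ≡.refl) → ret ((r +₂ r' , j) ∷ l₀ , k∉l₀ ∷ u₀ , xs⊆x∷xs (j ∷ ids l₀) j ,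
          ≈²-trans (≋⇒≈² (≋-sym (·-assoc (act r (v j)) (act r' (v j)) (combo b l₀))))
                   (≈²-·-cong (act-+ r r' (v j) (proj₂ (b j))) ≈²-refl))
        (no j≢k) → combo-insert r j l₀ u₀ λ (l , u , l⊆ , eq) → ret ((r' , k) ∷ l ,
          anti-mono l⊆ ((λ k≡j → j≢k (≡.sym k≡j)) ∷ k∉l₀) ∷ u ,
          ∈-∷⁺ʳ (there (here ≡.refl)) (⊆-trans l⊆ (∷⁺ʳ j (xs⊆x∷xs (ids l₀) k))) ,
          ≈²-trans (≋⇒≈² (·-left-comm (act r (v j)) (act r' (v k)) (combo b l₀)))
                   (≈²-·-cong ≈²-refl eq))

      -- Only doubly negated: merging needs to decide equality of basis indices.
      combo-merge : ∀ l → DoubleNegation (∃ λ l₀ → Unique (ids l₀) × combo b l ≈² combo b l₀)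
      combo-merge []            ret = ret ([] , [] , ≈²-refl)
      combo-merge ((r , j) ∷ l) ret =
        combo-merge l λ (l₀ , u₀ , l≈²l₀) →
        combo-insert r j l₀ u₀ λ (l₁ , u₁ , _ , eq) →
        ret (l₁ , u₁ , ≈²-trans (≈²-·-cong ≈²-refl l≈²l₀) eq)

      ids-map₁ : ∀ f l → ids (map (map₁ f) l) ≡.≡ ids l
      ids-map₁ f l = ≡.sym (map-∘ l)

      combo-[1+σ] : ∀ l → combo b l · σ (combo b l) ≈² combo b (map (map₁ [1+σ]*_) l)
      combo-[1+σ] []            = ≋⇒≈² (≋-trans (·-cong (≋-refl {oneE}) σ-oneE) (·-identityʳ oneE))
      combo-[1+σ] ((r , j) ∷ l) = ≈²-trans (≋⇒≈² regroup)
        (≈²-·-cong (act-[1+σ] r (v j) (proj₂ (b j))) (combo-[1+σ] l))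
        where
        x : E
        x = act r (v j)
        y : E
        y = combo b l
        regroup : (x · y) · σ (x · y) ≋ (x · σ x) · (y · σ y)
        regroup = ≋-trans (·-cong (≋-refl {x · y}) (σ-homo x y)) (·-interchange x y (σ x) (σ y))

      combo-scalar : ∀ l → All (λ p → isZero (proj₁ p)) (map (map₁ [1+σ]*_) l) →
                     IsScalar (combo b l)
      combo-scalar []            []          = refl
      combo-scalar ((r , j) ∷ l) (r∈ker ∷ ps) = IsScalar-· (act r (v j)) (combo b l)
        (act-scalar r (v j) r∈ker) (combo-scalar l ps)

    module _ (√-1 : HasSqrtMinus1 F) where
      i : Carrier
      i = proj₁ √-1

      √a : E
      √a = 0# , 1#

      √a-nonzero : Nonzero √a
      √a-nonzero (_ , 1≈0) = 1≉0 1≈0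

      √a·σ√a≈²1 : √a · σ √a ≈² oneE
      √a·σ√a≈²1 = (i√a , i√a-nonzero) , ≋-trans √a·σ√a≋i√a² (≋-sym (·-identityˡ (i√a · i√a)))
        where
        i√a : E
        i√a = 0# , i
        i√a-nonzero : Nonzero i√a
        i√a-nonzero (_ , i≈0) = 1≉0 (begin
          1#          ≈⟨ -‿involutive 1# ⟨
          - (- 1#)    ≈⟨ -‿cong (proj₂ √-1) ⟨
          - (i * i)   ≈⟨ -‿cong (x≈0⇒x*y≈0 i i≈0) ⟩
          - 0#        ≈⟨ -0#≈0# ⟩
          0#          ∎)
          where open ≈-Reasoning
        0*x+y*0≈0 : ∀ x y → 0# * x + y * 0# ≈ 0#
        0*x+y*0≈0 x y = trans (+-cong (zeroˡ x) (zeroʳ y)) (+-identityʳ 0#)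
        √a·σ√a≋i√a² : √a · σ √a ≋ i√a · i√a
        √a·σ√a≋i√a² = ⟪ +-congˡ (*-congˡ (trans (*-identityˡ (- 1#)) (sym (proj₂ √-1))))
                      , trans (0*x+y*0≈0 (- 1#) 1#) (sym (0*x+y*0≈0 i i)) ⟫

      √a-not-scalar : ∀ z → IsScalar z → ¬ (√a ≈² z)
      √a-not-scalar (c′ , d) d≈0 (((p , q) , _) , ⟪ e₁ , e₂ ⟫) =
        nonsquare (square-of-ratio ipip≈aqq q≉0)
        where
        open ≈-Reasoning
        n = p * p + a * (q * q)
        tr = p * q + q * p
        c′n≈0 : c′ * n ≈ 0#
        c′n≈0 = trans (sym (trans (+-congˡ (y≈0⇒x*y≈0 a (x≈0⇒x*y≈0 tr d≈0))) (+-identityʳ _))) (sym e₁)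
        c′tr≈1 : c′ * tr ≈ 1#
        c′tr≈1 = trans (sym (trans (+-congˡ (x≈0⇒x*y≈0 n d≈0)) (+-identityʳ _))) (sym e₂)
        c′≉0 : ¬ (c′ ≈ 0#)
        c′≉0 c′≈0 = 1≉0 (trans (sym c′tr≈1) (x≈0⇒x*y≈0 tr c′≈0))
        q≉0 : ¬ (q ≈ 0#)
        q≉0 q≈0 = 1≉0 (trans (sym c′tr≈1)
          (y≈0⇒x*y≈0 c′ (trans (+-cong (y≈0⇒x*y≈0 p q≈0) (x≈0⇒x*y≈0 p q≈0)) (+-identityʳ 0#))))
        pp≈-aqq : p * p ≈ - (a * (q * q))
        pp≈-aqq = +-inverseˡ-unique (p * p) _ (*-cancelˡ-≈0 c′≉0 c′n≈0)
        ipip≈aqq : (i * p) * (i * p) ≈ a * (q * q)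
        ipip≈aqq = begin
          (i * p) * (i * p)              ≈⟨ solve 2 (λ i p → (i :* p) :* (i :* p) := (i :* i) :* (p :* p))
                                              refl i p ⟩
          (i * i) * (p * p)              ≈⟨ *-cong (proj₂ √-1) pp≈-aqq ⟩
          (- 1#) * (- (a * (q * q)))     ≈⟨ -1*x≈-x _ ⟩
          - (- (a * (q * q)))            ≈⟨ -‿involutive _ ⟩
          a * (q * q)                    ∎

      k₁E-not-free : ¬ k₁E-IsFree F a
      k₁E-not-free (B , b , spans , independent) with spans (√a , √a-nonzero)
      ... | l , _ , t , l∼√a = combo-merge l λ (l₀ , u₀ , l≈²l₀) →
        let l₀≈²√a = ≈²-trans (≈²-sym l≈²l₀) (t , ⟪ l∼√a ⟫)
        in √a-not-scalar (combo b l₀) (combo-scalar l₀ (coordinates-in-kernel l₀ u₀ l₀≈²√a))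
             (≈²-sym l₀≈²√a)
        where
        open Combinations b
        coordinates-in-kernel : ∀ l₀ → Unique (ids l₀) → combo b l₀ ≈² √a →
                                All (λ p → isZero (proj₁ p)) (map (map₁ [1+σ]*_) l₀)
        coordinates-in-kernel l₀ u₀ l₀≈²√a =
          independent (map (map₁ [1+σ]*_) l₀) (≡.subst Unique (≡.sym (ids-map₁ [1+σ]*_ l₀)) u₀)
            (combo-nonzero (map (map₁ [1+σ]*_) l₀)) (proj₁ image≈²1 , components (proj₂ image≈²1))
          where
          image≈²1 : combo b (map (map₁ [1+σ]*_) l₀) ≈² oneE
          image≈²1 = ≈²-trans (≈²-sym (combo-[1+σ] l₀))
            (≈²-trans (≈²-·-cong l₀≈²√a (≈²-σ-cong l₀≈²√a)) √a·σ√a≈²1)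

-- The argument never divides by 2.
corollary5 : ∀ {c ℓ : Level} (F : Field c ℓ) (a : Field.Carrier F) →
    CharNot2 F → HasSqrtMinus1 F → IsNonSquareUnit F a → ¬ k₁E-IsFree F a
corollary5 F a _ √-1 (_ , nonsquare) = QuadraticAlgebra.k₁E-not-free F a nonsquare √-1
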